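{- For every integer $n\ge 1$, the polynomials $P_n$ defined in the context satisfy $$P_n(q;x_1,\dots,x_n;y_1,\dots,y_n)=\sum_{i=1}^{n} y_i^{\,n-i}\,P_{n-1}\bigl(q;\,x_1,\dots,x_{i-1},\,qx_{i+1},\dots,qx_n;\ y_1,\dots,y_{i-1},\,x_iy_{i+1},\dots,x_iy_n\bigr),$$ where $P_0:=1$.
   Context: For a permutation $\pi=\pi_1\cdots\pi_n$ of $\{1,\dots,n\}$ and a pattern $\sigma\in S_k$, let $N_\sigma(\pi)$ be the number of index tuples $1\le i_1<\dots<i_k\le n$ such that $\pi_{i_1},\dots,\pi_{i_k}$ are in the same relative order as $\sigma_1,\dots,\sigma_k$. For $\pi\in S_n$ define $$\mathrm{weight}(\pi)=q^{N_{[1,2,3,4]}(\pi)}\prod_{i=1}^n x_i^{|\{1\le a<b<c\le n:\ \pi_a=i<\pi_b<\pi_c\}|}\, y_i^{|\{1\le a<b\le n:\ \pi_a=i<\pi_b\}|},$$ and $P_n(q;x_1,\dots,x_n;y_1,\dots,y_n)=\sum_{\pi\in S_n}\mathrm{weight}(\pi)$, a polynomial in $q,x_1,\dots,x_n,y_1,\dots,y_n$. -}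

module Defs where

open import Level using (Level)
open import Data.Nat using (ℕ; zero; suc) renaming (_+_ to _+ℕ_)
import Data.Nat
open import Data.Fin using (Fin; toℕ; punchIn) renaming (_<_ to _<ᶠ_; _<?_ to _<ᶠ?_)
import Data.Fin as F
open import Data.Fin.Properties using (_≟_)
open import Data.Vec using (Vec; []; _∷_; lookup; toList)
open import Data.List using (List; []; _∷_; map; concatMap; filter; allFin; foldr)
open import Data.Product using (_×_)
open import Relation.Nullary using (Dec; yes; no)
open import Relation.Nullary.Decidable using (_×-dec_)
open import Relation.Binary.PropositionalEquality using (_≡_)
open import Algebra.Bundles using (CommutativeRing)
import Data.List.Relation.Unary.Unique.DecPropositional as UniqueDec

ind : ∀ {p} {P : Set p} → Dec P → ℕ
ind (yes _) = 1
ind (no _)  = 0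

Σℕ : (n : ℕ) → (Fin n → ℕ) → ℕ
Σℕ n f = foldr _+ℕ_ 0 (map f (allFin n))

words : (n k : ℕ) → List (Vec (Fin n) k)
words n zero = [] ∷ []
words n (suc k) = concatMap (λ a → map (a ∷_) (words n k)) (allFin n)

-- S_n : the permutations of {0,…,n-1} in one-line notation
-- (words of length n over Fin n with pairwise distinct letters)
perms : (n : ℕ) → List (Vec (Fin n) n)
perms n = filter (λ v → UniqueDec.unique? _≟_ (toList v)) (words n n)

module _ {n : ℕ} (π : Vec (Fin n) n) where
  private
    p : Fin n → Fin n
    p = lookup π

  N1234 : ℕ
  N1234 = Σℕ n λ a → Σℕ n λ b → Σℕ n λ c → Σℕ n λ d →
    ind ((a <ᶠ? b) ×-dec (b <ᶠ? c) ×-dec (c <ᶠ? d) ×-dec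
         (p a <ᶠ? p b) ×-dec (p b <ᶠ? p c) ×-dec (p c <ᶠ? p d))

  xExp : Fin n → ℕ
  xExp i = Σℕ n λ a → Σℕ n λ b → Σℕ n λ c →
    ind ((a <ᶠ? b) ×-dec (b <ᶠ? c) ×-dec (p a ≟ i) ×-dec
         (i <ᶠ? p b) ×-dec (p b <ᶠ? p c))

  yExp : Fin n → ℕ
  yExp i = Σℕ n λ a → Σℕ n λ b →
    ind ((a <ᶠ? b) ×-dec (p a ≟ i) ×-dec (i <ᶠ? p b))

module Poly {c ℓ : Level} (R : CommutativeRing c ℓ) where
  open CommutativeRing R

  pow : Carrier → ℕ → Carrier
  pow x zero = 1#
  pow x (suc k) = x * pow x k

  ΣR : (n : ℕ) → (Fin n → Carrier) → Carrier
  ΣR n f = foldr _+_ 0# (map f (allFin n))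

  ΠR : (n : ℕ) → (Fin n → Carrier) → Carrier
  ΠR n f = foldr _*_ 1# (map f (allFin n))

  -- weight(π), variables x_i, y_i indexed by i ∈ Fin n (i ↔ value i+1)
  weight : (n : ℕ) → Carrier → (Fin n → Carrier) → (Fin n → Carrier) →
           Vec (Fin n) n → Carrier
  weight n q x y π =
    pow q (N1234 π) * ΠR n (λ i → pow (x i) (xExp π i) * pow (y i) (yExp π i))

  -- P_n(q; x; y) evaluated in R  (P_0 = 1 automatically: S_0 = {empty perm})
  P : (n : ℕ) → Carrier → (Fin n → Carrier) → (Fin n → Carrier) → Carrier
  P n q x y = foldr _+_ 0# (map (weight n q x y) (perms n))

  -- substituted variables for the i-th summand:
  -- x_1..x_{i-1}, q x_{i+1}..q x_n   and   y_1..y_{i-1}, x_i y_{i+1}..x_i y_n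
  xSub : {n : ℕ} → Carrier → (Fin (suc n) → Carrier) → Fin (suc n) → Fin n → Carrier
  xSub q x i j with toℕ j Data.Nat.<? toℕ i
  ... | yes _ = x (punchIn i j)
  ... | no _  = q * x (punchIn i j)

  ySub : {n : ℕ} → (Fin (suc n) → Carrier) → (Fin (suc n) → Carrier) →
         Fin (suc n) → Fin n → Carrier
  ySub x y i j with toℕ j Data.Nat.<? toℕ i
  ... | yes _ = y (punchIn i j)
  ... | no _  = x i * y (punchIn i j)

module Submission where

open import Defs
open import Level using (Level)
open import Data.Nat using (ℕ; suc; _∸_)
open import Data.Fin using (Fin; toℕ)
open import Algebra.Bundles using (CommutativeRing)

open import Algebra.Bundles using (CommutativeMonoid)
import Algebra.Properties.Semiring.Sum
open import Data.Bool using (Bool; true; false; if_then_else_; not; _∧_)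
open import Data.Fin using (zero; suc; punchIn; _<_; _≤_; _<?_; _≤?_)
open import Data.Fin.Properties using (_≟_; punchIn-injective; punchInᵢ≢i; punchIn-mono-≤; punchIn-cancel-≤)
open import Data.List using (List; []; _∷_; _++_; foldr; filter; concatMap; allFin; tabulate)
import Data.List as List
open import Data.List.Properties using (map-tabulate; map-∘)
open import Data.List.Relation.Unary.All using (All; all?)
open import Data.List.Relation.Unary.Unique.Propositional using (Unique)
import Data.List.Relation.Unary.Unique.Propositional.Properties as Unique
import Data.List.Relation.Unary.Unique.DecPropositional as UniqueDec
open import Data.Nat using (zero; z≤n; s≤s; s≤s⁻¹; s<s; s<s⁻¹; z<s)
import Data.Nat as ℕ using (_+_; _*_; _<?_)
import Data.Nat.Properties as ℕ
open import Data.Product using (_×_; _,_)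
open import Data.Vec using (Vec; []; _∷_; lookup; map; toList)
open import Data.Vec.Properties using (lookup-map; toList-map)
import Data.Vec.Functional as Vector
open import Function using (_∘_; id; _⇔_; mk⇔)
open import Relation.Nullary using (Dec; yes; no; does; ¬_; ¬?; contradiction)
open import Relation.Nullary.Decidable using (_×-dec_; dec-true; dec-false; does-⇔)
open import Relation.Binary.PropositionalEquality
  using (_≡_; _≢_; _≗_; refl; sym; trans; cong; cong₂; subst; module ≡-Reasoning)

-- Every permutation of Fin (suc n) is uniquely  prepend i σ : the value i followed by a
-- permutation σ of Fin n whose values ≥ i are shifted up by punchIn i.  An occurrence of a
-- pattern in prepend i σ either avoids the first position, and is then an occurrence in σ,
-- or starts with the value i.  So the leading i contributes y_i^(n-i), one factor per larger
-- value; a 12 of σ whose 1 lies above i becomes a 123 starting at i, so x_i accompanies every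
-- y_j with j above i; and a 123 of σ starting above i becomes a 1234, so q accompanies every
-- such x_j.  Hence weight (prepend i σ) = y_i^(n-i) · weight σ at the substituted variables,
-- and enumerating S_(n+1) by first value gives the recursion.

private
  variable
    ℓ₁ ℓ₂ ℓ₃ ℓ₄ : Level
    A : Set ℓ₁
    B : Set ℓ₂
    Φ : Set ℓ₃
    Ψ : Set ℓ₄

foldr-tabulate : (_∙_ : A → A → A) (e : A) (n : ℕ) (f : Fin n → A) →
                 foldr _∙_ e (tabulate f) ≡ Vector.foldr _∙_ e f
foldr-tabulate _∙_ e zero    f = refl
foldr-tabulate _∙_ e (suc n) f = cong (f zero ∙_) (foldr-tabulate _∙_ e n (f ∘ suc))

foldr-allFin : (_∙_ : A → A → A) (e : A) (n : ℕ) (f : Fin n → A) →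
               foldr _∙_ e (List.map f (allFin n)) ≡ Vector.foldr _∙_ e f
foldr-allFin _∙_ e n f = trans (cong (foldr _∙_ e) (map-tabulate id f)) (foldr-tabulate _∙_ e n f)

ind-⇔ : (Φ? : Dec Φ) (Ψ? : Dec Ψ) → (Φ → Ψ) → (Ψ → Φ) → ind Φ? ≡ ind Ψ?
ind-⇔ (yes _) (yes _) _   _   = refl
ind-⇔ (yes φ) (no ¬ψ) Φ→Ψ _   = contradiction (Φ→Ψ φ) ¬ψ
ind-⇔ (no ¬φ) (yes ψ) _   Ψ→Φ = contradiction (Ψ→Φ ψ) ¬φ
ind-⇔ (no _)  (no _)  _   _   = refl

ind-¬ : (Φ? : Dec Φ) → ¬ Φ → ind Φ? ≡ 0
ind-¬ (yes φ) ¬φ = contradiction φ ¬φ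
ind-¬ (no _)  _  = refl

punchIn-mono-< : ∀ {n} (i : Fin (suc n)) {u v : Fin n} → u < v → punchIn i u < punchIn i v
punchIn-mono-< i {u} {v} u<v = ℕ.≰⇒> (ℕ.<⇒≱ u<v ∘ punchIn-cancel-≤ i v u)

punchIn-cancel-< : ∀ {n} (i : Fin (suc n)) {u v : Fin n} → punchIn i u < punchIn i v → u < v
punchIn-cancel-< i {u} {v} lt = ℕ.≰⇒> (ℕ.<⇒≱ lt ∘ punchIn-mono-≤ i v u)

≤⇒<punchIn : ∀ {n} (i : Fin (suc n)) (j : Fin n) → i ≤ j → i < punchIn i j
≤⇒<punchIn zero    j       _         = z<s
≤⇒<punchIn (suc i) (suc j) (s≤s i≤j) = s<s (≤⇒<punchIn i j i≤j)

<punchIn⇒≤ : ∀ {n} (i : Fin (suc n)) (j : Fin n) → i < punchIn i j → i ≤ j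
<punchIn⇒≤ zero    j       _         = z≤n
<punchIn⇒≤ (suc i) (suc j) (s<s lt)  = s≤s (<punchIn⇒≤ i j lt)

prepend : ∀ {n} → Fin (suc n) → Vec (Fin n) n → Vec (Fin (suc n)) (suc n)
prepend i σ = i ∷ map (punchIn i) σ

-- Permutations, built up by first value just as perms enumerates them.
data IsPermutation : ∀ {n} → Vec (Fin n) n → Set where
  []   : IsPermutation []
  _∷ᵖ_ : ∀ {n} (i : Fin (suc n)) {σ : Vec (Fin n) n} → IsPermutation σ → IsPermutation (prepend i σ)

module FinFold {c ℓ} (M : CommutativeMonoid c ℓ) where
  open CommutativeMonoid M renaming (refl to ≈-refl; sym to ≈-sym)
  open import Algebra.Properties.CommutativeMonoid.Sum M
  open import Relation.Binary.Reasoning.Setoid setoid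

  fold : (n : ℕ) → (Fin n → Carrier) → Carrier
  fold n f = foldr _∙_ ε (List.map f (allFin n))

  fold≡sum : ∀ n (f : Fin n → Carrier) → fold n f ≡ sum f
  fold≡sum = foldr-allFin _∙_ ε

  fold-cong : ∀ n {f g : Fin n → Carrier} → (∀ j → f j ≈ g j) → fold n f ≈ fold n g
  fold-cong n {f} {g} f≈g = begin
    fold n f ≡⟨ fold≡sum n f ⟩
    sum f    ≈⟨ sum-cong-≋ f≈g ⟩
    sum g    ≡⟨ fold≡sum n g ⟨
    fold n g ∎

  fold-remove : ∀ {n} (i : Fin (suc n)) (f : Fin (suc n) → Carrier) → fold (suc n) f ≈ f i ∙ fold n (f ∘ punchIn i)
  fold-remove {n} i f = begin
    fold (suc n) f                ≡⟨ fold≡sum (suc n) f ⟩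
    sum f                         ≈⟨ sum-remove f ⟩
    f i ∙ sum (f ∘ punchIn i)     ≡⟨ cong (f i ∙_) (fold≡sum n (f ∘ punchIn i)) ⟨
    f i ∙ fold n (f ∘ punchIn i)  ∎

  sum-permute-lookup : ∀ {n} {σ : Vec (Fin n) n} → IsPermutation σ →
                       ∀ (f : Fin n → Carrier) → sum (f ∘ lookup σ) ≈ sum f
  sum-permute-lookup []                  f = ≈-refl
  sum-permute-lookup (_∷ᵖ_ i {σ} σ-perm) f = begin
    f i ∙ sum (f ∘ lookup (map (punchIn i) σ))
      ≡⟨ cong (f i ∙_) (sum-cong-≗ λ b → cong f (lookup-map b (punchIn i) σ)) ⟩
    f i ∙ sum (f ∘ punchIn i ∘ lookup σ)
      ≈⟨ ∙-congˡ (sum-permute-lookup σ-perm (f ∘ punchIn i)) ⟩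
    f i ∙ sum (f ∘ punchIn i)
      ≈⟨ sum-remove f ⟨
    sum f ∎

module Counting where
  open import Data.Nat using (_+_; _*_)

  ind-× : (Φ? : Dec Φ) (Ψ? : Dec Ψ) → ind (Φ? ×-dec Ψ?) ≡ ind Φ? * ind Ψ?
  ind-× (yes _) (yes _) = refl
  ind-× (yes _) (no _)  = refl
  ind-× (no _)  (yes _) = refl
  ind-× (no _)  (no _)  = refl

  module NatSum = Algebra.Properties.Semiring.Sum ℕ.+-*-semiring
  open NatSum using (sum; sum-cong-≗; sum-remove; ∑-comm; *-distribˡ-sum; sum-syntax)

  sum-zero : ∀ {n} {f : Fin n → ℕ} → (∀ a → f a ≡ 0) → sum f ≡ 0
  sum-zero {n} f≗0 = trans (sum-cong-≗ f≗0) (NatSum.sum-replicate-zero n)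

  +-vanishˡ : ∀ {x y z} → x ≡ 0 → y ≡ z → x + y ≡ z
  +-vanishˡ refl y≡z = y≡z

  +-vanishʳ : ∀ {x y z} → x ≡ z → y ≡ 0 → x + y ≡ z
  +-vanishʳ {x} refl refl = ℕ.+-identityʳ x

  sum-delta : ∀ {n} (k : Fin n) {f : Fin n → ℕ} → (∀ j → j ≢ k → f j ≡ 0) → sum f ≡ f k
  sum-delta {suc n} k {f} f≗0 =
    trans (sum-remove f) (+-vanishʳ refl (sum-zero λ j → f≗0 (punchIn k j) (punchInᵢ≢i k j)))

  -- The statistics of Defs for an arbitrary function p in place of  lookup π, summed with the
  -- library's sum, under which a sum over Fin (suc n) unfolds to its zeroth term plus the rest.
  module Statistics {m : ℕ} (p : Fin m → Fin m) where
    Occ1234 : (a b c d : Fin m) → Set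
    Occ1234 a b c d = a < b × b < c × c < d × p a < p b × p b < p c × p c < p d

    occ1234? : ∀ a b c d → Dec (Occ1234 a b c d)
    occ1234? a b c d = (a <? b) ×-dec (b <? c) ×-dec (c <? d) ×-dec (p a <? p b) ×-dec (p b <? p c) ×-dec (p c <? p d)

    Occ123 : (k a b c : Fin m) → Set
    Occ123 k a b c = a < b × b < c × p a ≡ k × k < p b × p b < p c

    occ123? : ∀ k a b c → Dec (Occ123 k a b c)
    occ123? k a b c = (a <? b) ×-dec (b <? c) ×-dec (p a ≟ k) ×-dec (k <? p b) ×-dec (p b <? p c)

    Occ12 : (k a b : Fin m) → Set
    Occ12 k a b = a < b × p a ≡ k × k < p b

    occ12? : ∀ k a b → Dec (Occ12 k a b)
    occ12? k a b = (a <? b) ×-dec (p a ≟ k) ×-dec (k <? p b)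

    N1234ᶠ : ℕ
    N1234ᶠ = ∑[ a < m ] ∑[ b < m ] ∑[ c < m ] ∑[ d < m ] ind (occ1234? a b c d)

    xExpᶠ : Fin m → ℕ
    xExpᶠ k = ∑[ a < m ] ∑[ b < m ] ∑[ c < m ] ind (occ123? k a b c)

    yExpᶠ : Fin m → ℕ
    yExpᶠ k = ∑[ a < m ] ∑[ b < m ] ind (occ12? k a b)

    weighted-yExp : (w : Fin m → ℕ) →
                    ∑[ j < m ] (w j * yExpᶠ j) ≡ ∑[ a < m ] ∑[ b < m ] (w (p a) * ind (occ12? (p a) a b))
    weighted-yExp w = begin
      ∑[ j < m ] (w j * yExpᶠ j)
        ≡⟨ sum-cong-≗ (λ j → trans (*-distribˡ-sum (w j) (λ a → ∑[ b < m ] ind (occ12? j a b)))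
                                    (sum-cong-≗ λ a → *-distribˡ-sum (w j) (λ b → ind (occ12? j a b)))) ⟩
      ∑[ j < m ] ∑[ a < m ] ∑[ b < m ] (w j * ind (occ12? j a b))
        ≡⟨ ∑-comm {m} {m} _ ⟩
      ∑[ a < m ] ∑[ j < m ] ∑[ b < m ] (w j * ind (occ12? j a b))
        ≡⟨ sum-cong-≗ (λ a → ∑-comm λ j b → w j * ind (occ12? j a b)) ⟩
      ∑[ a < m ] ∑[ b < m ] ∑[ j < m ] (w j * ind (occ12? j a b))
        ≡⟨ sum-cong-≗ (λ a → sum-cong-≗ λ b → sum-delta (p a) λ j j≢pa →
             trans (cong (w j *_) (ind-¬ (occ12? j a b) λ (_ , pa≡j , _) → j≢pa (sym pa≡j))) (ℕ.*-zeroʳ (w j))) ⟩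
      ∑[ a < m ] ∑[ b < m ] (w (p a) * ind (occ12? (p a) a b)) ∎
      where open ≡-Reasoning

    weighted-xExp : (w : Fin m → ℕ) →
                    ∑[ j < m ] (w j * xExpᶠ j) ≡ ∑[ a < m ] ∑[ b < m ] ∑[ c < m ] (w (p a) * ind (occ123? (p a) a b c))
    weighted-xExp w = begin
      ∑[ j < m ] (w j * xExpᶠ j)
        ≡⟨ sum-cong-≗ (λ j → trans (*-distribˡ-sum (w j) (λ a → ∑[ b < m ] ∑[ c < m ] ind (occ123? j a b c)))
             (sum-cong-≗ λ a → trans (*-distribˡ-sum (w j) (λ b → ∑[ c < m ] ind (occ123? j a b c)))
             (sum-cong-≗ λ b → *-distribˡ-sum (w j) (λ c → ind (occ123? j a b c))))) ⟩
      ∑[ j < m ] ∑[ a < m ] ∑[ b < m ] ∑[ c < m ] (w j * ind (occ123? j a b c))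
        ≡⟨ ∑-comm {m} {m} _ ⟩
      ∑[ a < m ] ∑[ j < m ] ∑[ b < m ] ∑[ c < m ] (w j * ind (occ123? j a b c))
        ≡⟨ sum-cong-≗ (λ a → ∑-comm λ j b → ∑[ c < m ] (w j * ind (occ123? j a b c))) ⟩
      ∑[ a < m ] ∑[ b < m ] ∑[ j < m ] ∑[ c < m ] (w j * ind (occ123? j a b c))
        ≡⟨ sum-cong-≗ (λ a → sum-cong-≗ λ b → ∑-comm λ j c → w j * ind (occ123? j a b c)) ⟩
      ∑[ a < m ] ∑[ b < m ] ∑[ c < m ] ∑[ j < m ] (w j * ind (occ123? j a b c))
        ≡⟨ sum-cong-≗ (λ a → sum-cong-≗ λ b → sum-cong-≗ λ c → sum-delta (p a) λ j j≢pa →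
             trans (cong (w j *_) (ind-¬ (occ123? j a b c) λ (_ , _ , pa≡j , _) → j≢pa (sym pa≡j))) (ℕ.*-zeroʳ (w j))) ⟩
      ∑[ a < m ] ∑[ b < m ] ∑[ c < m ] (w (p a) * ind (occ123? (p a) a b c)) ∎
      where open ≡-Reasoning

    occ1234-unordered≡0 : ∀ a b → ¬ a < b → ∑[ c < m ] ∑[ d < m ] ind (occ1234? a b c d) ≡ 0
    occ1234-unordered≡0 a b a≮b = sum-zero λ c → sum-zero λ d → ind-¬ (occ1234? a b c d) λ (a<b , _) → a≮b a<b

    occ1234-unordered₂≡0 : ∀ a b c → ¬ b < c → ∑[ d < m ] ind (occ1234? a b c d) ≡ 0
    occ1234-unordered₂≡0 a b c b≮c = sum-zero λ d → ind-¬ (occ1234? a b c d) λ (_ , b<c , _) → b≮c b<c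

    module _ (k : Fin m) where
      occ12-row≡0 : ∀ a → p a ≢ k → ∑[ b < m ] ind (occ12? k a b) ≡ 0
      occ12-row≡0 a pa≢k = sum-zero λ b → ind-¬ (occ12? k a b) λ (_ , pa≡k , _) → pa≢k pa≡k

      occ123-row≡0 : ∀ a → p a ≢ k → ∑[ b < m ] ∑[ c < m ] ind (occ123? k a b c) ≡ 0
      occ123-row≡0 a pa≢k = sum-zero λ b → sum-zero λ c → ind-¬ (occ123? k a b c) λ (_ , _ , pa≡k , _) → pa≢k pa≡k

      occ123-unordered≡0 : ∀ a b → ¬ a < b → ∑[ c < m ] ind (occ123? k a b c) ≡ 0
      occ123-unordered≡0 a b a≮b = sum-zero λ c → ind-¬ (occ123? k a b c) λ (a<b , _) → a≮b a<b

  open Statistics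

  Σℕ≡sum : ∀ {n} {f g : Fin n → ℕ} → f ≗ g → Σℕ n f ≡ sum g
  Σℕ≡sum {n} {f} f≗g = trans (foldr-allFin _+_ 0 n f) (sum-cong-≗ f≗g)

  N1234≡N1234ᶠ : ∀ {n} (π : Vec (Fin n) n) {p : Fin n → Fin n} → lookup π ≗ p → N1234 π ≡ N1234ᶠ p
  N1234≡N1234ᶠ π {p} π≗p = Σℕ≡sum λ a → Σℕ≡sum λ b → Σℕ≡sum λ c → Σℕ≡sum λ d → term a b c d
    where
    term : ∀ a b c d → ind (occ1234? (lookup π) a b c d) ≡ ind (occ1234? p a b c d)
    term a b c d rewrite π≗p a | π≗p b | π≗p c | π≗p d = refl

  xExp≡xExpᶠ : ∀ {n} (π : Vec (Fin n) n) {p : Fin n → Fin n} → lookup π ≗ p → ∀ k → xExp π k ≡ xExpᶠ p k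
  xExp≡xExpᶠ π {p} π≗p k = Σℕ≡sum λ a → Σℕ≡sum λ b → Σℕ≡sum λ c → term a b c
    where
    term : ∀ a b c → ind (occ123? (lookup π) k a b c) ≡ ind (occ123? p k a b c)
    term a b c rewrite π≗p a | π≗p b | π≗p c = refl

  yExp≡yExpᶠ : ∀ {n} (π : Vec (Fin n) n) {p : Fin n → Fin n} → lookup π ≗ p → ∀ k → yExp π k ≡ yExpᶠ p k
  yExp≡yExpᶠ π {p} π≗p k = Σℕ≡sum λ a → Σℕ≡sum λ b → term a b
    where
    term : ∀ a b → ind (occ12? (lookup π) k a b) ≡ ind (occ12? p k a b)
    term a b rewrite π≗p a | π≗p b = refl

  prependᶠ : ∀ {n} → Fin (suc n) → (Fin n → Fin n) → Fin (suc n) → Fin (suc n)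
  prependᶠ i s zero    = i
  prependᶠ i s (suc b) = punchIn i (s b)

  lookup-prepend : ∀ {n} (i : Fin (suc n)) (σ : Vec (Fin n) n) → lookup (prepend i σ) ≗ prependᶠ i (lookup σ)
  lookup-prepend i σ zero    = refl
  lookup-prepend i σ (suc b) = lookup-map b (punchIn i) σ

  module Prepended {n : ℕ} (i : Fin (suc n)) (s : Fin n → Fin n) where
    p : Fin (suc n) → Fin (suc n)
    p = prependᶠ i s

    occ12-punchIn : ∀ j a b → ind (occ12? p (punchIn i j) (suc a) (suc b)) ≡ ind (occ12? s j a b)
    occ12-punchIn j a b = ind-⇔ (occ12? p (punchIn i j) (suc a) (suc b)) (occ12? s j a b)
      (λ (a<b , e , lt) → s<s⁻¹ a<b , punchIn-injective i _ _ e , punchIn-cancel-< i lt)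
      (λ (a<b , e , lt) → s<s a<b , cong (punchIn i) e , punchIn-mono-< i lt)

    occ123-punchIn : ∀ j a b c → ind (occ123? p (punchIn i j) (suc a) (suc b) (suc c)) ≡ ind (occ123? s j a b c)
    occ123-punchIn j a b c = ind-⇔ (occ123? p (punchIn i j) (suc a) (suc b) (suc c)) (occ123? s j a b c)
      (λ (a<b , b<c , e , lt , lt′) → s<s⁻¹ a<b , s<s⁻¹ b<c , punchIn-injective i _ _ e ,
         punchIn-cancel-< i lt , punchIn-cancel-< i lt′)
      (λ (a<b , b<c , e , lt , lt′) → s<s a<b , s<s b<c , cong (punchIn i) e ,
         punchIn-mono-< i lt , punchIn-mono-< i lt′)

    occ1234-suc : ∀ a b c d → ind (occ1234? p (suc a) (suc b) (suc c) (suc d)) ≡ ind (occ1234? s a b c d)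
    occ1234-suc a b c d = ind-⇔ (occ1234? p (suc a) (suc b) (suc c) (suc d)) (occ1234? s a b c d)
      (λ (a<b , b<c , c<d , lt , lt′ , lt″) → s<s⁻¹ a<b , s<s⁻¹ b<c , s<s⁻¹ c<d ,
         punchIn-cancel-< i lt , punchIn-cancel-< i lt′ , punchIn-cancel-< i lt″)
      (λ (a<b , b<c , c<d , lt , lt′ , lt″) → s<s a<b , s<s b<c , s<s c<d ,
         punchIn-mono-< i lt , punchIn-mono-< i lt′ , punchIn-mono-< i lt″)

    occ12-first : ∀ b → ind (occ12? p i zero (suc b)) ≡ ind (i ≤? s b)
    occ12-first b = ind-⇔ (occ12? p i zero (suc b)) (i ≤? s b)
      (λ (_ , _ , lt) → <punchIn⇒≤ i (s b) lt)
      (λ i≤sb → z<s , refl , ≤⇒<punchIn i (s b) i≤sb)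

    occ123-first : ∀ b c → ind (occ123? p i zero (suc b) (suc c)) ≡ ind (i ≤? s b) * ind (occ12? s (s b) b c)
    occ123-first b c = trans
      (ind-⇔ (occ123? p i zero (suc b) (suc c)) ((i ≤? s b) ×-dec occ12? s (s b) b c)
        (λ (_ , b<c , _ , lt , lt′) → <punchIn⇒≤ i (s b) lt , s<s⁻¹ b<c , refl , punchIn-cancel-< i lt′)
        (λ (i≤sb , b<c , _ , lt) → z<s , s<s b<c , refl , ≤⇒<punchIn i (s b) i≤sb , punchIn-mono-< i lt))
      (ind-× (i ≤? s b) (occ12? s (s b) b c))

    occ1234-first : ∀ b c d → ind (occ1234? p zero (suc b) (suc c) (suc d)) ≡
                              ind (i ≤? s b) * ind (occ123? s (s b) b c d)
    occ1234-first b c d = trans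
      (ind-⇔ (occ1234? p zero (suc b) (suc c) (suc d)) ((i ≤? s b) ×-dec occ123? s (s b) b c d)
        (λ (_ , b<c , c<d , lt , lt′ , lt″) → <punchIn⇒≤ i (s b) lt , s<s⁻¹ b<c , s<s⁻¹ c<d , refl ,
           punchIn-cancel-< i lt′ , punchIn-cancel-< i lt″)
        (λ (i≤sb , b<c , c<d , _ , lt , lt′) → z<s , s<s b<c , s<s c<d , ≤⇒<punchIn i (s b) i≤sb ,
           punchIn-mono-< i lt , punchIn-mono-< i lt′))
      (ind-× (i ≤? s b) (occ123? s (s b) b c d))

    yExp-punchIn : ∀ j → yExpᶠ p (punchIn i j) ≡ yExpᶠ s j
    yExp-punchIn j = +-vanishˡ (occ12-row≡0 p k zero (punchInᵢ≢i i j ∘ sym))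
      (sum-cong-≗ λ a → +-vanishˡ (ind-¬ (occ12? p k (suc a) zero) λ { (() , _) })
                                   (sum-cong-≗ (occ12-punchIn j a)))
      where
      k : Fin (suc n)
      k = punchIn i j

    xExp-punchIn : ∀ j → xExpᶠ p (punchIn i j) ≡ xExpᶠ s j
    xExp-punchIn j = +-vanishˡ (occ123-row≡0 p k zero (punchInᵢ≢i i j ∘ sym))
      (sum-cong-≗ λ a → +-vanishˡ (occ123-unordered≡0 p k (suc a) zero λ ())
        (sum-cong-≗ λ b → +-vanishˡ (ind-¬ (occ123? p k (suc a) (suc b) zero) λ { (_ , () , _) })
                                     (sum-cong-≗ (occ123-punchIn j a b))))
      where
      k : Fin (suc n)
      k = punchIn i j

    yExp-first : yExpᶠ p i ≡ ∑[ b < n ] ind (i ≤? s b)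
    yExp-first = +-vanishʳ
      (+-vanishˡ (ind-¬ (occ12? p i zero zero) λ { (() , _) }) (sum-cong-≗ occ12-first))
      (sum-zero λ a → occ12-row≡0 p i (suc a) (punchInᵢ≢i i (s a)))

    xExp-first : xExpᶠ p i ≡ ∑[ j < n ] (ind (i ≤? j) * yExpᶠ s j)
    xExp-first = trans (+-vanishʳ first-row later-rows) (sym (weighted-yExp s (λ j → ind (i ≤? j))))
      where
      first-row : ∑[ b < suc n ] ∑[ c < suc n ] ind (occ123? p i zero b c) ≡
                  ∑[ b < n ] ∑[ c < n ] (ind (i ≤? s b) * ind (occ12? s (s b) b c))
      first-row = +-vanishˡ (occ123-unordered≡0 p i zero zero λ ())
        (sum-cong-≗ λ b → +-vanishˡ (ind-¬ (occ123? p i zero (suc b) zero) λ { (_ , () , _) })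
                                     (sum-cong-≗ (occ123-first b)))
      later-rows : ∑[ a < n ] ∑[ b < suc n ] ∑[ c < suc n ] ind (occ123? p i (suc a) b c) ≡ 0
      later-rows = sum-zero λ a → occ123-row≡0 p i (suc a) (punchInᵢ≢i i (s a))

    N1234-prepend : N1234ᶠ p ≡ N1234ᶠ s + ∑[ j < n ] (ind (i ≤? j) * xExpᶠ s j)
    N1234-prepend = begin
      N1234ᶠ p
        ≡⟨ cong₂ _+_ first-row (sum-cong-≗ later-row) ⟩
      new + N1234ᶠ s
        ≡⟨ ℕ.+-comm new (N1234ᶠ s) ⟩
      N1234ᶠ s + new
        ≡⟨ cong (N1234ᶠ s +_) (weighted-xExp s (λ j → ind (i ≤? j))) ⟨
      N1234ᶠ s + ∑[ j < n ] (ind (i ≤? j) * xExpᶠ s j) ∎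
      where
      open ≡-Reasoning
      new : ℕ
      new = ∑[ b < n ] ∑[ c < n ] ∑[ d < n ] (ind (i ≤? s b) * ind (occ123? s (s b) b c d))
      first-row : ∑[ b < suc n ] ∑[ c < suc n ] ∑[ d < suc n ] ind (occ1234? p zero b c d) ≡ new
      first-row = +-vanishˡ (occ1234-unordered≡0 p zero zero λ ())
        (sum-cong-≗ λ b → +-vanishˡ (occ1234-unordered₂≡0 p zero (suc b) zero λ ())
          (sum-cong-≗ λ c → +-vanishˡ (ind-¬ (occ1234? p zero (suc b) (suc c) zero) λ { (_ , _ , () , _) })
                                       (sum-cong-≗ (occ1234-first b c))))
      later-row : ∀ a → ∑[ b < suc n ] ∑[ c < suc n ] ∑[ d < suc n ] ind (occ1234? p (suc a) b c d) ≡
                        ∑[ b < n ] ∑[ c < n ] ∑[ d < n ] ind (occ1234? s a b c d)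
      later-row a = +-vanishˡ (occ1234-unordered≡0 p (suc a) zero λ ())
        (sum-cong-≗ λ b → +-vanishˡ (occ1234-unordered₂≡0 p (suc a) (suc b) zero λ ())
          (sum-cong-≗ λ c → +-vanishˡ (ind-¬ (occ1234? p (suc a) (suc b) (suc c) zero) λ { (_ , _ , () , _) })
                                       (sum-cong-≗ (occ1234-suc a b c))))

  count-above : ∀ {n} (i : Fin (suc n)) → ∑[ u < n ] ind (i ≤? u) ≡ n ∸ toℕ i
  count-above {zero}  zero    = refl
  count-above {zero}  (suc ())
  count-above {suc n} zero    = cong suc (count-above {n} zero)
  count-above {suc n} (suc i) = +-vanishˡ (ind-¬ (suc i ≤? zero {n}) λ ()) (begin
    ∑[ u < n ] ind (suc i ≤? suc u) ≡⟨ sum-cong-≗ {n} (λ u → ind-⇔ (suc i ≤? suc u) (i ≤? u) s≤s⁻¹ s≤s) ⟩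
    ∑[ u < n ] ind (i ≤? u)         ≡⟨ count-above i ⟩
    n ∸ toℕ i                       ∎)
    where open ≡-Reasoning

  module _ {n : ℕ} (i : Fin (suc n)) (σ : Vec (Fin n) n) where
    private
      module σ′ = Prepended i (lookup σ)
      π≗p : lookup (prepend i σ) ≗ prependᶠ i (lookup σ)
      π≗p = lookup-prepend i σ
      σ≗σ : lookup σ ≗ lookup σ
      σ≗σ _ = refl

    N1234-prepend : N1234 (prepend i σ) ≡ N1234 σ + ∑[ j < n ] (ind (i ≤? j) * xExp σ j)
    N1234-prepend = begin
      N1234 (prepend i σ)                                           ≡⟨ N1234≡N1234ᶠ (prepend i σ) π≗p ⟩
      N1234ᶠ (prependᶠ i (lookup σ))                                 ≡⟨ σ′.N1234-prepend ⟩
      N1234ᶠ (lookup σ) + ∑[ j < n ] (ind (i ≤? j) * xExpᶠ (lookup σ) j)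
        ≡⟨ cong₂ _+_ (N1234≡N1234ᶠ σ σ≗σ)
                     (sum-cong-≗ λ j → cong (ind (i ≤? j) *_) (xExp≡xExpᶠ σ σ≗σ j)) ⟨
      N1234 σ + ∑[ j < n ] (ind (i ≤? j) * xExp σ j)               ∎
      where open ≡-Reasoning

    xExp-prepend-first : xExp (prepend i σ) i ≡ ∑[ j < n ] (ind (i ≤? j) * yExp σ j)
    xExp-prepend-first = trans (xExp≡xExpᶠ (prepend i σ) π≗p i) (trans σ′.xExp-first
      (sum-cong-≗ λ j → cong (ind (i ≤? j) *_) (sym (yExp≡yExpᶠ σ σ≗σ j))))

    yExp-prepend-first : IsPermutation σ → yExp (prepend i σ) i ≡ n ∸ toℕ i
    yExp-prepend-first σ-perm = trans (yExp≡yExpᶠ (prepend i σ) π≗p i) (trans σ′.yExp-first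
      (trans (FinFold.sum-permute-lookup ℕ.+-0-commutativeMonoid σ-perm (λ u → ind (i ≤? u))) (count-above i)))

    xExp-prepend-punchIn : ∀ j → xExp (prepend i σ) (punchIn i j) ≡ xExp σ j
    xExp-prepend-punchIn j = trans (xExp≡xExpᶠ (prepend i σ) π≗p (punchIn i j))
                                   (trans (σ′.xExp-punchIn j) (sym (xExp≡xExpᶠ σ σ≗σ j)))

    yExp-prepend-punchIn : ∀ j → yExp (prepend i σ) (punchIn i j) ≡ yExp σ j
    yExp-prepend-punchIn j = trans (yExp≡yExpᶠ (prepend i σ) π≗p (punchIn i j))
                                   (trans (σ′.yExp-punchIn j) (sym (yExp≡yExpᶠ σ σ≗σ j)))

module Weight {r ℓ} (R : CommutativeRing r ℓ) where
  open CommutativeRing R hiding (zero) renaming (refl to ≈-refl; sym to ≈-sym; trans to ≈-trans)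
  open Poly R
  open Counting using (N1234-prepend; xExp-prepend-first; yExp-prepend-first; xExp-prepend-punchIn; yExp-prepend-punchIn)
  open Counting.NatSum using () renaming (sum to sumℕ)
  open FinFold *-commutativeMonoid
    using () renaming (fold≡sum to ΠR≡product; fold-cong to ΠR-cong; fold-remove to ΠR-remove)
  open import Algebra.Properties.CommutativeMonoid.Sum *-commutativeMonoid
    using () renaming (sum to product; ∑-distrib-+ to product-distrib)
  open import Algebra.Properties.CommutativeSemiring.Exp commutativeSemiring using (_^_; ^-homo-*; ^-assocʳ; ^-distrib-*)
  open import Algebra.Properties.CommutativeSemigroup *-commutativeSemigroup using (interchange)
  open import Algebra.Solver.CommutativeMonoid *-commutativeMonoid using (solve; _⊕_; _⊜_)
  open import Relation.Binary.Reasoning.Setoid setoid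

  pow≡^ : ∀ x n → pow x n ≡ x ^ n
  pow≡^ x zero    = refl
  pow≡^ x (suc n) = cong (x *_) (pow≡^ x n)

  pow-congˡ : ∀ {x y} n → x ≈ y → pow x n ≈ pow y n
  pow-congˡ zero    x≈y = ≈-refl
  pow-congˡ (suc n) x≈y = *-cong x≈y (pow-congˡ n x≈y)

  pow-homo-+ : ∀ x m n → pow x (m ℕ.+ n) ≈ pow x m * pow x n
  pow-homo-+ x m n rewrite pow≡^ x (m ℕ.+ n) | pow≡^ x m | pow≡^ x n = ^-homo-* x m n

  pow-distrib-* : ∀ x y n → pow (x * y) n ≈ pow x n * pow y n
  pow-distrib-* x y n rewrite pow≡^ (x * y) n | pow≡^ x n | pow≡^ y n = ^-distrib-* x y n

  pow-assocʳ : ∀ x m n → pow (pow x m) n ≈ pow x (m ℕ.* n)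
  pow-assocʳ x m n rewrite pow≡^ (pow x m) n | pow≡^ x m | pow≡^ x (m ℕ.* n) = ^-assocʳ x m n

  ΠR-pow : ∀ n x (e : Fin n → ℕ) → ΠR n (λ j → pow x (e j)) ≈ pow x (sumℕ e)
  ΠR-pow n x e = ≈-trans (reflexive (ΠR≡product n _)) (product-pow n e)
    where
    product-pow : ∀ n (e : Fin n → ℕ) → product (λ j → pow x (e j)) ≈ pow x (sumℕ e)
    product-pow zero    e = ≈-refl
    product-pow (suc n) e =
      ≈-trans (*-congˡ (product-pow n (e ∘ suc))) (≈-sym (pow-homo-+ x (e zero) (sumℕ (e ∘ suc))))

  ΠR-distrib : ∀ n (f g : Fin n → Carrier) → ΠR n (λ j → f j * g j) ≈ ΠR n f * ΠR n g
  ΠR-distrib n f g = begin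
    ΠR n (λ j → f j * g j)     ≡⟨ ΠR≡product n _ ⟩
    product (λ j → f j * g j)  ≈⟨ product-distrib f g ⟩
    product f * product g      ≡⟨ cong₂ _*_ (ΠR≡product n f) (ΠR≡product n g) ⟨
    ΠR n f * ΠR n g            ∎

  xSub-above : ∀ {n} q (x : Fin (suc n) → Carrier) i j → xSub q x i j ≈ pow q (ind (i ≤? j)) * x (punchIn i j)
  xSub-above q x i j with toℕ j ℕ.<? toℕ i | i ≤? j
  ... | yes j<i | yes i≤j = contradiction i≤j (ℕ.<⇒≱ j<i)
  ... | yes _   | no _    = ≈-sym (*-identityˡ _)
  ... | no _    | yes _   = *-congʳ (≈-sym (*-identityʳ q))
  ... | no j≮i  | no i≰j  = contradiction (ℕ.≮⇒≥ j≮i) i≰j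

  ySub-above : ∀ {n} (x y : Fin (suc n) → Carrier) i j → ySub x y i j ≈ pow (x i) (ind (i ≤? j)) * y (punchIn i j)
  ySub-above x y i j with toℕ j ℕ.<? toℕ i | i ≤? j
  ... | yes j<i | yes i≤j = contradiction i≤j (ℕ.<⇒≱ j<i)
  ... | yes _   | no _    = ≈-sym (*-identityˡ _)
  ... | no _    | yes _   = *-congʳ (≈-sym (*-identityʳ (x i)))
  ... | no j≮i  | no i≰j  = contradiction (ℕ.≮⇒≥ j≮i) i≰j

  module _ {n : ℕ} (q : Carrier) (x y : Fin (suc n) → Carrier) (i : Fin (suc n)) where
    substituted-monomial : ∀ j e f →
      pow (xSub q x i j) e * pow (ySub x y i j) f ≈
      (pow q (ind (i ≤? j) ℕ.* e) * pow (x i) (ind (i ≤? j) ℕ.* f)) *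
      (pow (x (punchIn i j)) e * pow (y (punchIn i j)) f)
    substituted-monomial j e f = begin
      pow (xSub q x i j) e * pow (ySub x y i j) f
        ≈⟨ *-cong (pow-congˡ e (xSub-above q x i j)) (pow-congˡ f (ySub-above x y i j)) ⟩
      pow (pow q c * x′) e * pow (pow (x i) c * y′) f
        ≈⟨ *-cong (pow-distrib-* (pow q c) x′ e) (pow-distrib-* (pow (x i) c) y′ f) ⟩
      (pow (pow q c) e * pow x′ e) * (pow (pow (x i) c) f * pow y′ f)
        ≈⟨ *-cong (*-congʳ (pow-assocʳ q c e)) (*-congʳ (pow-assocʳ (x i) c f)) ⟩
      (pow q (c ℕ.* e) * pow x′ e) * (pow (x i) (c ℕ.* f) * pow y′ f)
        ≈⟨ interchange _ _ _ _ ⟩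
      (pow q (c ℕ.* e) * pow (x i) (c ℕ.* f)) * (pow x′ e * pow y′ f) ∎
      where
      c : ℕ
      c = ind (i ≤? j)
      x′ y′ : Carrier
      x′ = x (punchIn i j)
      y′ = y (punchIn i j)

    substituted-product : ∀ (e f : Fin n → ℕ) →
      ΠR n (λ j → pow (xSub q x i j) (e j) * pow (ySub x y i j) (f j)) ≈
      (pow q (sumℕ λ j → ind (i ≤? j) ℕ.* e j) * pow (x i) (sumℕ λ j → ind (i ≤? j) ℕ.* f j)) *
      ΠR n (λ j → pow (x (punchIn i j)) (e j) * pow (y (punchIn i j)) (f j))
    substituted-product e f = begin
      ΠR n (λ j → pow (xSub q x i j) (e j) * pow (ySub x y i j) (f j))
        ≈⟨ ΠR-cong n (λ j → substituted-monomial j (e j) (f j)) ⟩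
      ΠR n (λ j → (pow q (c j ℕ.* e j) * pow (x i) (c j ℕ.* f j)) * unchanged j)
        ≈⟨ ΠR-distrib n _ unchanged ⟩
      ΠR n (λ j → pow q (c j ℕ.* e j) * pow (x i) (c j ℕ.* f j)) * ΠR n unchanged
        ≈⟨ *-congʳ (ΠR-distrib n _ _) ⟩
      (ΠR n (λ j → pow q (c j ℕ.* e j)) * ΠR n (λ j → pow (x i) (c j ℕ.* f j))) * ΠR n unchanged
        ≈⟨ *-congʳ (*-cong (ΠR-pow n q _) (ΠR-pow n (x i) _)) ⟩
      (pow q (sumℕ λ j → c j ℕ.* e j) * pow (x i) (sumℕ λ j → c j ℕ.* f j)) * ΠR n unchanged ∎
      where
      c : Fin n → ℕ
      c j = ind (i ≤? j)
      unchanged : Fin n → Carrier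
      unchanged j = pow (x (punchIn i j)) (e j) * pow (y (punchIn i j)) (f j)

    weight-prepend : ∀ {σ : Vec (Fin n) n} → IsPermutation σ →
      weight (suc n) q x y (prepend i σ) ≈ pow (y i) (n ∸ toℕ i) * weight n q (xSub q x i) (ySub x y i) σ
    weight-prepend {σ} σ-perm = begin
      pow q (N1234 π) * ΠR (suc n) F
        ≈⟨ *-congˡ (ΠR-remove i F) ⟩
      pow q (N1234 π) * (F i * ΠR n (F ∘ punchIn i))
        ≡⟨ cong₂ (λ N Fi → pow q N * (Fi * ΠR n (F ∘ punchIn i))) (N1234-prepend i σ)
                 (cong₂ (λ u v → pow (x i) u * pow (y i) v)
                        (xExp-prepend-first i σ) (yExp-prepend-first i σ σ-perm)) ⟩
      pow q (N1234 σ ℕ.+ nq) * ((pow (x i) nx * pow (y i) ny) * ΠR n (F ∘ punchIn i))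
        ≈⟨ *-cong (pow-homo-+ q (N1234 σ) nq) (*-congˡ (ΠR-cong n λ j → reflexive
             (cong₂ (λ u v → pow (x (punchIn i j)) u * pow (y (punchIn i j)) v)
                    (xExp-prepend-punchIn i σ j) (yExp-prepend-punchIn i σ j)))) ⟩
      (pow q (N1234 σ) * pow q nq) * ((pow (x i) nx * pow (y i) ny) * Γ)
        ≈⟨ solve 5 (λ a b c d g → (a ⊕ b) ⊕ ((c ⊕ d) ⊕ g) ⊜ d ⊕ (a ⊕ ((b ⊕ c) ⊕ g))) ≈-refl _ _ _ _ _ ⟩
      pow (y i) ny * (pow q (N1234 σ) * ((pow q nq * pow (x i) nx) * Γ))
        ≈⟨ *-congˡ (*-congˡ (substituted-product (xExp σ) (yExp σ))) ⟨
      pow (y i) ny * (pow q (N1234 σ) *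
                      ΠR n (λ j → pow (xSub q x i j) (xExp σ j) * pow (ySub x y i j) (yExp σ j))) ∎
      where
      π : Vec (Fin (suc n)) (suc n)
      π = prepend i σ
      F : Fin (suc n) → Carrier
      F k = pow (x k) (xExp π k) * pow (y k) (yExp π k)
      nq nx ny : ℕ
      nq = sumℕ λ j → ind (i ≤? j) ℕ.* xExp σ j
      nx = sumℕ λ j → ind (i ≤? j) ℕ.* yExp σ j
      ny = n ∸ toℕ i
      Γ : Carrier
      Γ = ΠR n (λ j → pow (x (punchIn i j)) (xExp σ j) * pow (y (punchIn i j)) (yExp σ j))

avoids? : ∀ {n k} (a : Fin n) (w : Vec (Fin n) k) → Dec (All (a ≢_) (toList w))
avoids? a w = all? (λ b → ¬? (a ≟ b)) (toList w)

unique? : ∀ {n k} (w : Vec (Fin n) k) → Dec (Unique (toList w))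
unique? w = UniqueDec.unique? _≟_ (toList w)

unique-map-punchIn : ∀ {n k} (a : Fin (suc n)) (w : Vec (Fin n) k) →
                     Unique (toList (map (punchIn a) w)) ⇔ Unique (toList w)
unique-map-punchIn a w = mk⇔
  (λ u → Unique.map⁻ (subst Unique (toList-map (punchIn a) w) u))
  (λ u → subst Unique (sym (toList-map (punchIn a) w)) (Unique.map⁺ (punchIn-injective a _ _) u))

module Enumeration {r ℓ} (R : CommutativeRing r ℓ) where
  open CommutativeRing R hiding (zero) renaming (refl to ≈-refl; sym to ≈-sym; trans to ≈-trans)
  open Poly R
  open FinFold +-commutativeMonoid using () renaming (fold-cong to ΣR-cong; fold-remove to ΣR-remove)
  open import Relation.Binary.Reasoning.Setoid setoid

  sumList : List A → (A → Carrier) → Carrier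
  sumList xs f = foldr _+_ 0# (List.map f xs)

  _when_ : Carrier → Bool → Carrier
  x when b = if b then x else 0#

  when-∧ : ∀ b c x → x when (b ∧ c) ≡ (x when c) when b
  when-∧ true  c x = refl
  when-∧ false c x = refl

  sumList-cong : (xs : List A) {f g : A → Carrier} → (∀ x → f x ≈ g x) → sumList xs f ≈ sumList xs g
  sumList-cong []       f≈g = ≈-refl
  sumList-cong (x ∷ xs) f≈g = +-cong (f≈g x) (sumList-cong xs f≈g)

  sumList-++ : (xs ys : List A) (f : A → Carrier) → sumList (xs ++ ys) f ≈ sumList xs f + sumList ys f
  sumList-++ []       ys f = ≈-sym (+-identityˡ _)
  sumList-++ (x ∷ xs) ys f = ≈-trans (+-congˡ (sumList-++ xs ys f)) (≈-sym (+-assoc _ _ _))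

  sumList-map : (h : A → B) (xs : List A) (f : B → Carrier) → sumList (List.map h xs) f ≡ sumList xs (f ∘ h)
  sumList-map h xs f = cong (foldr _+_ 0#) (sym (map-∘ xs))

  sumList-concatMap : (g : A → List B) (xs : List A) (f : B → Carrier) →
                      sumList (concatMap g xs) f ≈ sumList xs (λ x → sumList (g x) f)
  sumList-concatMap g []       f = ≈-refl
  sumList-concatMap g (x ∷ xs) f = ≈-trans (sumList-++ (g x) (concatMap g xs) f) (+-congˡ (sumList-concatMap g xs f))

  sumList-filter : {P : A → Set ℓ₃} (P? : ∀ x → Dec (P x)) (xs : List A) (f : A → Carrier) →
                   sumList (filter P? xs) f ≈ sumList xs (λ x → f x when does (P? x))
  sumList-filter P? []       f = ≈-refl
  sumList-filter P? (x ∷ xs) f with does (P? x)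
  ... | true  = +-congˡ (sumList-filter P? xs f)
  ... | false = ≈-trans (sumList-filter P? xs f) (≈-sym (+-identityˡ _))

  sumList-when : (xs : List A) (b : Bool) (f : A → Carrier) → sumList xs (λ x → f x when b) ≈ sumList xs f when b
  sumList-when xs       true  f = ≈-refl
  sumList-when []       false f = ≈-refl
  sumList-when (x ∷ xs) false f = ≈-trans (+-identityˡ _) (sumList-when xs false f)

  sumList-*ˡ : (xs : List A) (c : Carrier) (f : A → Carrier) → sumList xs (λ x → c * f x) ≈ c * sumList xs f
  sumList-*ˡ []       c f = ≈-sym (zeroʳ c)
  sumList-*ˡ (x ∷ xs) c f = ≈-trans (+-congˡ (sumList-*ˡ xs c f)) (≈-sym (distribˡ c (f x) _))

  sum-words-suc : ∀ n k (f : Vec (Fin n) (suc k) → Carrier) →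
                  sumList (words n (suc k)) f ≈ ΣR n (λ b → sumList (words n k) (λ w → f (b ∷ w)))
  sum-words-suc n k f = ≈-trans (sumList-concatMap (λ b → List.map (b ∷_) (words n k)) (allFin n) f)
    (ΣR-cong n λ b → reflexive (sumList-map (b ∷_) (words n k) f))

  sum-words-avoiding : ∀ {n} k (a : Fin (suc n)) (g : Vec (Fin (suc n)) k → Carrier) →
    sumList (words (suc n) k) (λ w → g w when does (avoids? a w)) ≈ sumList (words n k) (g ∘ map (punchIn a))
  sum-words-avoiding zero    a g = ≈-refl
  sum-words-avoiding {n} (suc k) a g = begin
    sumList (words (suc n) (suc k)) (λ w → g w when does (avoids? a w))
      -- does (avoids? a (b ∷ w)) unfolds to  not (does (a ≟ b)) ∧ does (avoids? a w)
      ≈⟨ sum-words-suc (suc n) k _ ⟩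
    ΣR (suc n) (λ b → sumList (words (suc n) k) (λ w → g (b ∷ w) when (not (does (a ≟ b)) ∧ does (avoids? a w))))
      ≈⟨ ΣR-cong (suc n) (λ b → ≈-trans (sumList-cong (words (suc n) k) λ w →
                                              reflexive (when-∧ (not (does (a ≟ b))) (does (avoids? a w)) (g (b ∷ w))))
                                          (sumList-when (words (suc n) k) (not (does (a ≟ b))) _)) ⟩
    ΣR (suc n) (λ b → rest b when not (does (a ≟ b)))
      ≈⟨ ΣR-remove a _ ⟩
    rest a when not (does (a ≟ a)) + ΣR n (λ j → rest (punchIn a j) when not (does (a ≟ punchIn a j)))
      ≈⟨ +-cong (reflexive (cong (λ t → rest a when not t) (dec-true (a ≟ a) refl)))
                (ΣR-cong n λ j → reflexive (cong (λ t → rest (punchIn a j) when not t)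
                                                  (dec-false (a ≟ punchIn a j) (punchInᵢ≢i a j ∘ sym)))) ⟩
    0# + ΣR n (λ j → rest (punchIn a j))
      ≈⟨ +-identityˡ _ ⟩
    ΣR n (λ j → rest (punchIn a j))
      ≈⟨ ΣR-cong n (λ j → sum-words-avoiding k a (λ w → g (punchIn a j ∷ w))) ⟩
    ΣR n (λ j → sumList (words n k) (λ w → g (punchIn a j ∷ map (punchIn a) w)))
      ≈⟨ sum-words-suc n k _ ⟨
    sumList (words n (suc k)) (g ∘ map (punchIn a)) ∎
    where
    rest : Fin (suc n) → Carrier
    rest b = sumList (words (suc n) k) (λ w → g (b ∷ w) when does (avoids? a w))

  sum-perms-suc : ∀ n (f : Vec (Fin (suc n)) (suc n) → Carrier) →
                  sumList (perms (suc n)) f ≈ ΣR (suc n) (λ i → sumList (perms n) (f ∘ prepend i))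
  sum-perms-suc n f = begin
    sumList (perms (suc n)) f
      ≈⟨ sumList-filter unique? (words (suc n) (suc n)) f ⟩
    sumList (words (suc n) (suc n)) (λ w → f w when does (unique? w))
      ≈⟨ sum-words-suc (suc n) n _ ⟩
    ΣR (suc n) (λ i → sumList (words (suc n) n) (λ w → f (i ∷ w) when does (unique? (i ∷ w))))
      ≈⟨ ΣR-cong (suc n) first-letter ⟩
    ΣR (suc n) (λ i → sumList (perms n) (f ∘ prepend i)) ∎
    where
    first-letter : ∀ i → sumList (words (suc n) n) (λ w → f (i ∷ w) when does (unique? (i ∷ w))) ≈
                         sumList (perms n) (f ∘ prepend i)
    first-letter i = begin
      sumList (words (suc n) n) (λ w → f (i ∷ w) when does (unique? (i ∷ w)))
        -- does (unique? (i ∷ w)) unfolds to  does (avoids? i w) ∧ does (unique? w)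
        ≈⟨ sumList-cong (words (suc n) n) (λ w →
             reflexive (when-∧ (does (avoids? i w)) (does (unique? w)) (f (i ∷ w)))) ⟩
      sumList (words (suc n) n) (λ w → (f (i ∷ w) when does (unique? w)) when does (avoids? i w))
        ≈⟨ sum-words-avoiding n i (λ w → f (i ∷ w) when does (unique? w)) ⟩
      sumList (words n n) (λ w → f (prepend i w) when does (unique? (map (punchIn i) w)))
        ≈⟨ sumList-cong (words n n) (λ w → reflexive (cong (f (prepend i w) when_)
             (does-⇔ (unique-map-punchIn i w) (unique? (map (punchIn i) w)) (unique? w)))) ⟩
      sumList (words n n) (λ w → f (prepend i w) when does (unique? w))
        ≈⟨ sumList-filter unique? (words n n) (f ∘ prepend i) ⟨
      sumList (perms n) (f ∘ prepend i) ∎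

  sum-perms-cong : ∀ n {f g : Vec (Fin n) n → Carrier} → (∀ {σ} → IsPermutation σ → f σ ≈ g σ) →
                   sumList (perms n) f ≈ sumList (perms n) g
  sum-perms-cong zero    f≈g = +-congʳ (f≈g [])
  sum-perms-cong (suc n) {f} {g} f≈g = begin
    sumList (perms (suc n)) f
      ≈⟨ sum-perms-suc n f ⟩
    ΣR (suc n) (λ i → sumList (perms n) (f ∘ prepend i))
      ≈⟨ ΣR-cong (suc n) (λ i → sum-perms-cong n (f≈g ∘ (i ∷ᵖ_))) ⟩
    ΣR (suc n) (λ i → sumList (perms n) (g ∘ prepend i))
      ≈⟨ sum-perms-suc n g ⟨
    sumList (perms (suc n)) g ∎

mainTheorem3 : ∀ {c ℓ : Level} (R : CommutativeRing c ℓ) →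
    let open CommutativeRing R
        open Poly R
    in ∀ (n : ℕ) (q : Carrier) (x y : Fin (suc n) → Carrier) →
       P (suc n) q x y ≈
       ΣR (suc n) (λ i → pow (y i) (n ∸ toℕ i) * P n q (xSub q x i) (ySub x y i))
mainTheorem3 R n q x y = begin
  P (suc n) q x y
    ≈⟨ sum-perms-suc n (weight (suc n) q x y) ⟩
  ΣR (suc n) (λ i → sumList (perms n) (weight (suc n) q x y ∘ prepend i))
    ≈⟨ ΣR-cong (suc n) (λ i → sum-perms-cong n (weight-prepend q x y i)) ⟩
  ΣR (suc n) (λ i → sumList (perms n) λ σ →
                      pow (y i) (n ∸ toℕ i) * weight n q (xSub q x i) (ySub x y i) σ)
    ≈⟨ ΣR-cong (suc n) (λ i → sumList-*ˡ (perms n) (pow (y i) (n ∸ toℕ i)) _) ⟩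
  ΣR (suc n) (λ i → pow (y i) (n ∸ toℕ i) * P n q (xSub q x i) (ySub x y i)) ∎
  where
  open CommutativeRing R
  open Poly R
  open Weight R using (weight-prepend)
  open Enumeration R using (sumList; sum-perms-suc; sum-perms-cong; sumList-*ˡ)
  open FinFold +-commutativeMonoid using () renaming (fold-cong to ΣR-cong)
  open import Relation.Binary.Reasoning.Setoid setoid
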